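{- Let $q$ be a prime, $F=\mathbb{Z}/q\mathbb{Z}$, $F^*=F\setminus\{0\}$, let $A\subset F$ and let $G$ be a nonempty subset of $F^*$. Then there exists $\xi\in G$ such that $$|S_\xi(A)|\ge\frac{|A|^2|G|}{|A|^2+|G|}.$$
   Context: For $A\subset F$ and $\xi\in F$, $S_\xi(A):=\{a+b\xi:a,b\in A\}$. -}

module Defs where

open import Data.Nat using (ℕ; suc; NonZero; _%_; _+_; _*_)
open import Data.Nat.DivMod using (m%n<n)
open import Data.Fin using (Fin; toℕ; fromℕ<)
open import Data.Fin.Subset using (Subset; _∈_)
open import Data.Fin.Properties using (any?)
open import Data.Vec using (tabulate)
open import Data.Product using (_×_; ∃; ∃-syntax)
open import Relation.Binary.PropositionalEquality using (_≡_)
open import Relation.Nullary.Decidable using (⌊_⌋; _×-dec_)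
open import Data.Fin.Subset.Properties using (_∈?_)
open import Data.Fin.Properties using (_≟_)

_+F_ : ∀ {q} .{{_ : NonZero q}} → Fin q → Fin q → Fin q
_+F_ {q} a b = fromℕ< (m%n<n (toℕ a + toℕ b) q)

_*F_ : ∀ {q} .{{_ : NonZero q}} → Fin q → Fin q → Fin q
_*F_ {q} a b = fromℕ< (m%n<n (toℕ a * toℕ b) q)

S : ∀ {q} .{{_ : NonZero q}} → Fin q → Subset q → Subset q
S {q} ξ A = tabulate λ x →
  ⌊ any? (λ a → any? (λ b →
       (a ∈? A) ×-dec ((b ∈? A) ×-dec ((a +F (b *F ξ)) ≟ x)))) ⌋

-- For ξ ∈ F let r_ξ(x) be the number of (a, b) ∈ A² with a + bξ = x, and let
-- E(ξ) = Σ_x r_ξ(x)² be the number of quadruples (a, b, a′, b′) ∈ A⁴ with a + bξ = a′ + b′ξ.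
-- Since Σ_x r_ξ(x) = |A|² and r_ξ vanishes outside S_ξ(A), Cauchy–Schwarz gives
-- |A|⁴ ≤ |S_ξ(A)| E(ξ). On the other hand Σ_{ξ ∈ G} E(ξ) counts pairs of lines x ↦ a + bx,
-- x ↦ a′ + b′x meeting at a point of G; over the field F two distinct lines meet at most once,
-- while a line meets itself |G| times, so Σ_{ξ ∈ G} E(ξ) ≤ |A|²(|A|² + |G|). Hence some ξ ∈ G
-- has |G| E(ξ) ≤ |A|²(|A|² + |G|), and together with Cauchy–Schwarz this is the claim.
module Submission where

open import Defs
open import Data.Nat using (ℕ; _*_; _+_; _≤_; _<_; _>_; NonZero; _%_; _/_; ∣_-_∣; z≤n; s≤s; z<s; _≤?_; >-nonZero)
open import Data.Nat.Properties hiding (_≟_; suc-injective; 0≢1+n)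
open import Data.Nat.DivMod using (m≡m%n+[m/n]*n; %-distribˡ-+; m<n⇒m%n≡m; m%n%n≡m%n)
open import Data.Nat.Divisibility using (_∣_; divides; n∣m⇒m%n≡0)
open import Data.Nat.Primality using (Prime; euclidsLemma)
open import Data.Nat.Tactic.RingSolver using (solve-∀)
open import Data.Bool using (true; false; if_then_else_)
open import Data.Fin using (Fin; zero; suc; toℕ; _≟_)
open import Data.Fin.Properties using (toℕ-fromℕ<; toℕ-injective; toℕ<n; suc-injective; 0≢1+n; any?)
open import Data.Fin.Subset using (Subset; _∈_; _∉_; ∣_∣; Nonempty)
open import Data.Fin.Subset.Properties using (_∈?_)
open import Data.Vec using ([]; _∷_; lookup)
open import Data.Vec.Properties using (lookup⇒[]=; lookup∘tabulate)
open import Data.Product using (∃-syntax; _×_; _,_; proj₁; proj₂)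
open import Data.Sum using (_⊎_; inj₁; inj₂)
open import Function using (_∘_)
open import Relation.Nullary using (¬_; Dec; yes; no; does; contradiction)
open import Relation.Nullary.Decidable using (_×-dec_; isYes; isYes≗does; dec-true)
open import Relation.Binary.PropositionalEquality
open import Algebra.Properties.Semiring.Sum +-*-semiring
  using (sum; sum-syntax; sum-cong-≗; ∑-comm; ∑-distrib-+; *-distribˡ-sum; *-distribʳ-sum)

import Data.Nat as ℕ

-- Arithmetic in ℕ

private
  n≤m⇒2*[m*n]≤m*m+n*n : ∀ {m n} → n ≤ m → 2 * (m * n) ≤ m * m + n * n
  n≤m⇒2*[m*n]≤m*m+n*n {n = n} n≤m with m≤n⇒∃[o]m+o≡n n≤m
  ... | d , refl = begin
    2 * ((n + d) * n)         ≤⟨ m≤m+n _ (d * d) ⟩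
    2 * ((n + d) * n) + d * d ≡⟨ square-of-sum n d ⟩
    (n + d) * (n + d) + n * n ∎
    where
    open ≤-Reasoning
    square-of-sum : ∀ n d → 2 * ((n + d) * n) + d * d ≡ (n + d) * (n + d) + n * n
    square-of-sum = solve-∀

2*[m*n]≤m*m+n*n : ∀ m n → 2 * (m * n) ≤ m * m + n * n
2*[m*n]≤m*m+n*n m n with ≤-total n m
... | inj₁ n≤m = n≤m⇒2*[m*n]≤m*m+n*n n≤m
... | inj₂ m≤n = begin
  2 * (m * n)   ≡⟨ cong (2 *_) (*-comm m n) ⟩
  2 * (n * m)   ≤⟨ n≤m⇒2*[m*n]≤m*m+n*n m≤n ⟩
  n * n + m * m ≡⟨ +-comm (n * n) (m * m) ⟩
  m * m + n * n ∎
  where open ≤-Reasoning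

private
  n≤m⇒∣m*o+n*p-n*o+m*p∣≡∣m-n∣*∣o-p∣ : ∀ {m n} o p → n ≤ m →
    ∣ m * o + n * p - n * o + m * p ∣ ≡ ∣ m - n ∣ * ∣ o - p ∣
  n≤m⇒∣m*o+n*p-n*o+m*p∣≡∣m-n∣*∣o-p∣ {n = n} o p n≤m with m≤n⇒∃[o]m+o≡n n≤m
  ... | d , refl = begin
    ∣ (n + d) * o + n * p - n * o + (n + d) * p ∣ ≡⟨ cong₂ ∣_-_∣ (regroupˡ n d o p) (regroupʳ n d o p) ⟩
    ∣ n * (o + p) + d * o - n * (o + p) + d * p ∣ ≡⟨ ∣m+n-m+o∣≡∣n-o∣ (n * (o + p)) (d * o) (d * p) ⟩
    ∣ d * o - d * p ∣                             ≡⟨ *-distribˡ-∣-∣ d o p ⟨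
    d * ∣ o - p ∣                                 ≡⟨ cong (_* ∣ o - p ∣) (trans (∣-∣-comm (n + d) n) (∣m-m+n∣≡n n d)) ⟨
    ∣ n + d - n ∣ * ∣ o - p ∣                     ∎
    where
    open ≡-Reasoning
    regroupˡ : ∀ n d o p → (n + d) * o + n * p ≡ n * (o + p) + d * o
    regroupˡ = solve-∀
    regroupʳ : ∀ n d o p → n * o + (n + d) * p ≡ n * (o + p) + d * p
    regroupʳ = solve-∀

∣m*o+n*p-n*o+m*p∣≡∣m-n∣*∣o-p∣ : ∀ m n o p →
  ∣ m * o + n * p - n * o + m * p ∣ ≡ ∣ m - n ∣ * ∣ o - p ∣
∣m*o+n*p-n*o+m*p∣≡∣m-n∣*∣o-p∣ m n o p with ≤-total n m
... | inj₁ n≤m = n≤m⇒∣m*o+n*p-n*o+m*p∣≡∣m-n∣*∣o-p∣ o p n≤m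
... | inj₂ m≤n = begin
  ∣ m * o + n * p - n * o + m * p ∣ ≡⟨ ∣-∣-comm (m * o + n * p) _ ⟩
  ∣ n * o + m * p - m * o + n * p ∣ ≡⟨ n≤m⇒∣m*o+n*p-n*o+m*p∣≡∣m-n∣*∣o-p∣ o p m≤n ⟩
  ∣ n - m ∣ * ∣ o - p ∣             ≡⟨ cong (_* ∣ o - p ∣) (∣-∣-comm n m) ⟩
  ∣ m - n ∣ * ∣ o - p ∣             ∎
  where open ≡-Reasoning

m≤1⇒n≤1+o⇒m*n≤m+o : ∀ {m n o} → m ≤ 1 → n ≤ 1 + o → m * n ≤ m + o
m≤1⇒n≤1+o⇒m*n≤m+o {ℕ.zero}               _         _     = z≤n
m≤1⇒n≤1+o⇒m*n≤m+o {ℕ.suc ℕ.zero} {n}     _         n≤1+o = ≤-trans (≤-reflexive (+-identityʳ n)) n≤1+o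
m≤1⇒n≤1+o⇒m*n≤m+o {ℕ.suc (ℕ.suc _)}      (s≤s ())  _

m*m≤n*o⇒p*o≤m*[m+p]⇒m*p≤n*[m+p] : ∀ {m n o p} → m * m ≤ n * o → p * o ≤ m * (m + p) → m * p ≤ n * (m + p)
m*m≤n*o⇒p*o≤m*[m+p]⇒m*p≤n*[m+p] {ℕ.zero} _ _ = z≤n
m*m≤n*o⇒p*o≤m*[m+p]⇒m*p≤n*[m+p] {m@(ℕ.suc _)} {n} {o} {p} m*m≤n*o p*o≤m*[m+p] = *-cancelˡ-≤ m (begin
  m * (m * p)       ≡⟨ *-assoc m m p ⟨
  m * m * p         ≤⟨ *-monoˡ-≤ p m*m≤n*o ⟩
  n * o * p         ≡⟨ reorderˡ n o p ⟩
  n * (p * o)       ≤⟨ *-monoʳ-≤ n p*o≤m*[m+p] ⟩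
  n * (m * (m + p)) ≡⟨ reorderʳ n m (m + p) ⟩
  m * (n * (m + p)) ∎)
  where
  open ≤-Reasoning
  reorderˡ : ∀ n o p → n * o * p ≡ n * (p * o)
  reorderˡ = solve-∀
  reorderʳ : ∀ n m k → n * (m * k) ≡ m * (n * k)
  reorderʳ = solve-∀

-- Congruences modulo q and lines over F

module _ {q : ℕ} .{{_ : NonZero q}} where

  %-cong-+ : ∀ {m m′ n n′} → m % q ≡ m′ % q → n % q ≡ n′ % q → (m + n) % q ≡ (m′ + n′) % q
  %-cong-+ {m} {m′} {n} {n′} m≡m′ n≡n′ = begin
    (m + n) % q           ≡⟨ %-distribˡ-+ m n q ⟩
    (m % q + n % q) % q   ≡⟨ cong₂ (λ x y → (x + y) % q) m≡m′ n≡n′ ⟩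
    (m′ % q + n′ % q) % q ≡⟨ %-distribˡ-+ m′ n′ q ⟨
    (m′ + n′) % q         ∎
    where open ≡-Reasoning

  m%q≡n%q⇒q∣∣m-n∣ : ∀ {m n} → m % q ≡ n % q → q ∣ ∣ m - n ∣
  m%q≡n%q⇒q∣∣m-n∣ {m} {n} m≡n = divides ∣ m / q - n / q ∣ (begin
    ∣ m - n ∣                                 ≡⟨ cong₂ ∣_-_∣ (m≡m%n+[m/n]*n m q) (m≡m%n+[m/n]*n n q) ⟩
    ∣ m % q + m / q * q - n % q + n / q * q ∣ ≡⟨ cong (λ r → ∣ m % q + m / q * q - r + n / q * q ∣) m≡n ⟨
    ∣ m % q + m / q * q - m % q + n / q * q ∣ ≡⟨ ∣m+n-m+o∣≡∣n-o∣ (m % q) _ _ ⟩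
    ∣ m / q * q - n / q * q ∣                 ≡⟨ *-distribʳ-∣-∣ q (m / q) (n / q) ⟨
    ∣ m / q - n / q ∣ * q                     ∎)
    where open ≡-Reasoning

  [m+o]%q≡[n+o]%q⇒q∣∣m-n∣ : ∀ {m n} o → (m + o) % q ≡ (n + o) % q → q ∣ ∣ m - n ∣
  [m+o]%q≡[n+o]%q⇒q∣∣m-n∣ {m} {n} o m+o≡n+o = subst (q ∣_) ∣m+o-n+o∣≡∣m-n∣ (m%q≡n%q⇒q∣∣m-n∣ m+o≡n+o)
    where
    ∣m+o-n+o∣≡∣m-n∣ : ∣ m + o - n + o ∣ ≡ ∣ m - n ∣
    ∣m+o-n+o∣≡∣m-n∣ = trans (cong₂ ∣_-_∣ (+-comm m o) (+-comm n o)) (∣m+n-m+o∣≡∣n-o∣ o m n)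

  q∣∣m-n∣⇒m≡n : ∀ {m n} → m < q → n < q → q ∣ ∣ m - n ∣ → m ≡ n
  q∣∣m-n∣⇒m≡n {m} {n} m<q n<q q∣∣m-n∣ = ∣m-n∣≡0⇒m≡n (begin
    ∣ m - n ∣     ≡⟨ m<n⇒m%n≡m (≤-<-trans (∣m-n∣≤m⊔n m n) (⊔-lub m<q n<q)) ⟨
    ∣ m - n ∣ % q ≡⟨ n∣m⇒m%n≡0 _ q q∣∣m-n∣ ⟩
    0             ∎)
    where open ≡-Reasoning

  lines-congruent-twice⇒q∣∣b-b′∣*∣x-y∣ : ∀ a a′ b b′ x y →
    (a + b * x) % q ≡ (a′ + b′ * x) % q → (a + b * y) % q ≡ (a′ + b′ * y) % q →
    q ∣ ∣ b - b′ ∣ * ∣ x - y ∣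
  lines-congruent-twice⇒q∣∣b-b′∣*∣x-y∣ a a′ b b′ x y at-x at-y =
    subst (q ∣_) ∣difference∣ (m%q≡n%q⇒q∣∣m-n∣ (%-cong-+ at-x (sym at-y)))
    where
    open ≡-Reasoning
    regroupˡ : ∀ a a′ b b′ x y → a + b * x + (a′ + b′ * y) ≡ a + a′ + (b * x + b′ * y)
    regroupˡ = solve-∀
    regroupʳ : ∀ a a′ b b′ x y → a′ + b′ * x + (a + b * y) ≡ a + a′ + (b′ * x + b * y)
    regroupʳ = solve-∀
    ∣difference∣ : ∣ a + b * x + (a′ + b′ * y) - a′ + b′ * x + (a + b * y) ∣ ≡ ∣ b - b′ ∣ * ∣ x - y ∣
    ∣difference∣ = begin
      ∣ a + b * x + (a′ + b′ * y) - a′ + b′ * x + (a + b * y) ∣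
        ≡⟨ cong₂ ∣_-_∣ (regroupˡ a a′ b b′ x y) (regroupʳ a a′ b b′ x y) ⟩
      ∣ a + a′ + (b * x + b′ * y) - a + a′ + (b′ * x + b * y) ∣
        ≡⟨ ∣m+n-m+o∣≡∣n-o∣ (a + a′) _ _ ⟩
      ∣ b * x + b′ * y - b′ * x + b * y ∣
        ≡⟨ ∣m*o+n*p-n*o+m*p∣≡∣m-n∣*∣o-p∣ b b′ x y ⟩
      ∣ b - b′ ∣ * ∣ x - y ∣ ∎

  line : Fin q → Fin q → Fin q → Fin q
  line a b ξ = a +F (b *F ξ)

  toℕ-line : ∀ a b ξ → toℕ (line a b ξ) ≡ (toℕ a + toℕ b * toℕ ξ) % q
  toℕ-line a b ξ = begin
    toℕ (a +F (b *F ξ))               ≡⟨ toℕ-fromℕ< _ ⟩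
    (toℕ a + toℕ (b *F ξ)) % q        ≡⟨ cong (λ t → (toℕ a + t) % q) (toℕ-fromℕ< _) ⟩
    (toℕ a + (toℕ b * toℕ ξ) % q) % q ≡⟨ %-cong-+ refl (m%n%n≡m%n (toℕ b * toℕ ξ) q) ⟩
    (toℕ a + toℕ b * toℕ ξ) % q       ∎
    where open ≡-Reasoning

  line≡line⇒%≡% : ∀ a a′ b b′ ξ → line a b ξ ≡ line a′ b′ ξ →
    (toℕ a + toℕ b * toℕ ξ) % q ≡ (toℕ a′ + toℕ b′ * toℕ ξ) % q
  line≡line⇒%≡% a a′ b b′ ξ eq = trans (sym (toℕ-line a b ξ)) (trans (cong toℕ eq) (toℕ-line a′ b′ ξ))

  q∣∣i-j∣⇒i≡j : ∀ {i j : Fin q} → q ∣ ∣ toℕ i - toℕ j ∣ → i ≡ j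
  q∣∣i-j∣⇒i≡j {i} {j} = toℕ-injective ∘ q∣∣m-n∣⇒m≡n (toℕ<n i) (toℕ<n j)

  lines-meet-once : Prime q → ∀ {a a′ b b′ ξ η} →
    line a b ξ ≡ line a′ b′ ξ → line a b η ≡ line a′ b′ η → (a ≡ a′ × b ≡ b′) ⊎ ξ ≡ η
  lines-meet-once q-prime {a} {a′} {b} {b′} {ξ} {η} at-ξ at-η
    with euclidsLemma _ _ q-prime
           (lines-congruent-twice⇒q∣∣b-b′∣*∣x-y∣ (toℕ a) (toℕ a′) (toℕ b) (toℕ b′) (toℕ ξ) (toℕ η)
              (line≡line⇒%≡% a a′ b b′ ξ at-ξ) (line≡line⇒%≡% a a′ b b′ η at-η))
  ... | inj₂ q∣∣ξ-η∣ = inj₂ (q∣∣i-j∣⇒i≡j q∣∣ξ-η∣)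
  ... | inj₁ q∣∣b-b′∣ with q∣∣i-j∣⇒i≡j {b} {b′} q∣∣b-b′∣
  ... | refl = inj₁ (q∣∣i-j∣⇒i≡j ([m+o]%q≡[n+o]%q⇒q∣∣m-n∣ (toℕ b * toℕ ξ) (line≡line⇒%≡% a a′ b b ξ at-ξ)) , refl)

-- Finite sums and indicators

∑-mono-≤ : ∀ {n} {f g : Fin n → ℕ} → (∀ i → f i ≤ g i) → sum f ≤ sum g
∑-mono-≤ {ℕ.zero}  f≤g = z≤n
∑-mono-≤ {ℕ.suc n} f≤g = +-mono-≤ (f≤g zero) (∑-mono-≤ (f≤g ∘ suc))

∑*∑≡∑∑ : ∀ {m n} (f : Fin m → ℕ) (g : Fin n → ℕ) → sum f * sum g ≡ ∑[ i < m ] ∑[ j < n ] (f i * g j)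
∑*∑≡∑∑ f g = trans (*-distribʳ-sum (sum g) f) (sum-cong-≗ λ i → *-distribˡ-sum (f i) g)

∑*∑∑≡∑∑∑* : ∀ {l m n} (c : Fin l → ℕ) (F : Fin l → Fin m → Fin n → ℕ) →
  ∑[ k < l ] (c k * ∑[ i < m ] ∑[ j < n ] F k i j) ≡ ∑[ i < m ] ∑[ j < n ] ∑[ k < l ] (c k * F k i j)
∑*∑∑≡∑∑∑* {l} {m} {n} c F = begin
  ∑[ k < l ] (c k * ∑[ i < m ] ∑[ j < n ] F k i j) ≡⟨ sum-cong-≗ (λ k → *-distribˡ-sum (c k) (λ i → ∑[ j < n ] F k i j)) ⟩
  ∑[ k < l ] ∑[ i < m ] (c k * ∑[ j < n ] F k i j) ≡⟨ sum-cong-≗ (λ k → sum-cong-≗ (λ i → *-distribˡ-sum (c k) (F k i))) ⟩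
  ∑[ k < l ] ∑[ i < m ] ∑[ j < n ] (c k * F k i j) ≡⟨ ∑-comm (λ k i → ∑[ j < n ] (c k * F k i j)) ⟩
  ∑[ i < m ] ∑[ k < l ] ∑[ j < n ] (c k * F k i j) ≡⟨ sum-cong-≗ (λ i → ∑-comm (λ k j → c k * F k i j)) ⟩
  ∑[ i < m ] ∑[ j < n ] ∑[ k < l ] (c k * F k i j) ∎
  where open ≡-Reasoning

∑[c*[k*f]]≡k*∑[c*f] : ∀ {n} (c f : Fin n → ℕ) k → ∑[ i < n ] (c i * (k * f i)) ≡ k * ∑[ i < n ] (c i * f i)
∑[c*[k*f]]≡k*∑[c*f] c f k = trans (sum-cong-≗ λ i → reorder (c i) k (f i)) (sym (*-distribˡ-sum k (λ i → c i * f i)))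
  where
  reorder : ∀ c k f → c * (k * f) ≡ k * (c * f)
  reorder = solve-∀

∑-cauchy-schwarz : ∀ {n} (f g : Fin n → ℕ) →
  ∑[ i < n ] (f i * g i) * ∑[ i < n ] (f i * g i) ≤ ∑[ i < n ] (f i * f i) * ∑[ i < n ] (g i * g i)
∑-cauchy-schwarz {n} f g = *-cancelˡ-≤ 2 (begin
  2 * (sum fg * sum fg)                                            ≡⟨ cong (2 *_) (∑*∑≡∑∑ fg fg) ⟩
  2 * ∑[ i < n ] ∑[ j < n ] (fg i * fg j)                           ≡⟨ *-distribˡ-sum 2 (λ i → ∑[ j < n ] (fg i * fg j)) ⟩
  ∑[ i < n ] (2 * ∑[ j < n ] (fg i * fg j))                         ≡⟨ sum-cong-≗ (λ i → *-distribˡ-sum 2 (λ j → fg i * fg j)) ⟩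
  ∑[ i < n ] ∑[ j < n ] (2 * (fg i * fg j))                         ≤⟨ ∑-mono-≤ (λ i → ∑-mono-≤ (λ j → pointwise i j)) ⟩
  ∑[ i < n ] ∑[ j < n ] (ff i * gg j + ff j * gg i)                 ≡⟨ sum-cong-≗ (λ i → ∑-distrib-+ (λ j → ff i * gg j) (λ j → ff j * gg i)) ⟩
  ∑[ i < n ] (∑[ j < n ] (ff i * gg j) + ∑[ j < n ] (ff j * gg i))
                                                                   ≡⟨ ∑-distrib-+ (λ i → ∑[ j < n ] (ff i * gg j)) (λ i → ∑[ j < n ] (ff j * gg i)) ⟩
  ∑[ i < n ] ∑[ j < n ] (ff i * gg j) + ∑[ i < n ] ∑[ j < n ] (ff j * gg i)
                                                                   ≡⟨ cong (∑[ i < n ] ∑[ j < n ] (ff i * gg j) +_) (∑-comm (λ i j → ff j * gg i)) ⟩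
  ∑[ i < n ] ∑[ j < n ] (ff i * gg j) + ∑[ j < n ] ∑[ i < n ] (ff j * gg i)
                                                                   ≡⟨ cong₂ _+_ (∑*∑≡∑∑ ff gg) (∑*∑≡∑∑ ff gg) ⟨
  sum ff * sum gg + sum ff * sum gg                                ≡⟨ cong (sum ff * sum gg +_) (+-identityʳ (sum ff * sum gg)) ⟨
  2 * (sum ff * sum gg)                                            ∎)
  where
  open ≤-Reasoning
  fg ff gg : Fin n → ℕ
  fg i = f i * g i
  ff i = f i * f i
  gg i = g i * g i
  pointwise : ∀ i j → 2 * (fg i * fg j) ≤ ff i * gg j + ff j * gg i
  pointwise i j = subst₂ _≤_ (cong (2 *_) (product (f i) (g i) (f j) (g j))) (squares (f i) (g i) (f j) (g j))
    (2*[m*n]≤m*m+n*n (f i * g j) (f j * g i))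
    where
    product : ∀ a b c d → a * d * (c * b) ≡ a * b * (c * d)
    product = solve-∀
    squares : ∀ a b c d → a * d * (a * d) + c * b * (c * b) ≡ a * a * (d * d) + c * c * (b * b)
    squares = solve-∀

∑-≡0 : ∀ {n} {f : Fin n → ℕ} → (∀ i → f i ≡ 0) → sum f ≡ 0
∑-≡0 {ℕ.zero}  f≡0 = refl
∑-≡0 {ℕ.suc n} f≡0 = cong₂ _+_ (f≡0 zero) (∑-≡0 (f≡0 ∘ suc))

f≤∑f : ∀ {n} (f : Fin n → ℕ) i → f i ≤ sum f
f≤∑f f zero    = m≤m+n _ _
f≤∑f f (suc i) = ≤-trans (f≤∑f (f ∘ suc) i) (m≤n+m _ _)

𝟙 : ∀ {p} {P : Set p} → Dec P → ℕ
𝟙 P? = if does P? then 1 else 0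

module _ {p} {P : Set p} where

  𝟙≤1 : (P? : Dec P) → 𝟙 P? ≤ 1
  𝟙≤1 P? with does P?
  ... | true  = ≤-refl
  ... | false = z≤n

  𝟙*𝟙≡𝟙 : (P? : Dec P) → 𝟙 P? * 𝟙 P? ≡ 𝟙 P?
  𝟙*𝟙≡𝟙 P? with does P?
  ... | true  = refl
  ... | false = refl

  𝟙-yes : (P? : Dec P) → P → 𝟙 P? ≡ 1
  𝟙-yes (yes _) _ = refl
  𝟙-yes (no ¬p) p = contradiction p ¬p

  𝟙-no : (P? : Dec P) → ¬ P → 𝟙 P? ≡ 0
  𝟙-no (yes p) ¬p = contradiction p ¬p
  𝟙-no (no _)  _  = refl

𝟙-×-dec : ∀ {p q} {P : Set p} {Q : Set q} (P? : Dec P) (Q? : Dec Q) → 𝟙 (P? ×-dec Q?) ≡ 𝟙 P? * 𝟙 Q?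
𝟙-×-dec P? Q? with does P? | does Q?
... | true  | true  = refl
... | true  | false = refl
... | false | _     = refl

∑-δ : ∀ {n} (u : Fin n) (h : Fin n → ℕ) → ∑[ x < n ] (𝟙 (u ≟ x) * h x) ≡ h u
∑-δ zero    h = trans (cong₂ _+_ (*-identityˡ (h zero)) (∑-≡0 {f = λ x → 𝟙 (zero ≟ suc x) * h (suc x)} λ _ → refl))
                      (+-identityʳ (h zero))
∑-δ (suc u) h = ∑-δ u (h ∘ suc)

∑-𝟙-≤1 : ∀ {n p} {P : Fin n → Set p} (P? : ∀ i → Dec (P i)) →
  (∀ {i j} → P i → P j → i ≡ j) → ∑[ i < n ] 𝟙 (P? i) ≤ 1
∑-𝟙-≤1 {ℕ.zero}  P? unique = z≤n
∑-𝟙-≤1 {ℕ.suc n} P? unique with P? zero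
... | yes p₀ = ≤-reflexive (cong ℕ.suc (∑-≡0 {n} {λ i → 𝟙 (P? (suc i))} λ i →
                 𝟙-no (P? (suc i)) (λ pᵢ → 0≢1+n (unique p₀ pᵢ))))
... | no  _  = ∑-𝟙-≤1 (P? ∘ suc) (λ pᵢ pⱼ → suc-injective (unique pᵢ pⱼ))

∣p∣≡∑𝟙∈ : ∀ {n} (p : Subset n) → ∣ p ∣ ≡ ∑[ x < n ] 𝟙 (x ∈? p)
∣p∣≡∑𝟙∈ []          = refl
∣p∣≡∑𝟙∈ (true  ∷ p) = cong ℕ.suc (∣p∣≡∑𝟙∈ p)
∣p∣≡∑𝟙∈ (false ∷ p) = ∣p∣≡∑𝟙∈ p

∑-cauchy-schwarz-support : ∀ {n} (p : Subset n) (g : Fin n → ℕ) → (∀ x → x ∉ p → g x ≡ 0) →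
  sum g * sum g ≤ ∣ p ∣ * ∑[ x < n ] (g x * g x)
∑-cauchy-schwarz-support {n} p g g≡0 = begin
  sum g * sum g                                          ≡⟨ cong₂ _*_ ∑g≡∑𝟙g ∑g≡∑𝟙g ⟩
  sum 𝟙g * sum 𝟙g                                        ≤⟨ ∑-cauchy-schwarz (λ x → 𝟙 (x ∈? p)) g ⟩
  ∑[ x < n ] (𝟙 (x ∈? p) * 𝟙 (x ∈? p)) * sum (λ x → g x * g x)
                                                         ≡⟨ cong (_* sum (λ x → g x * g x)) ∑𝟙𝟙≡∣p∣ ⟩
  ∣ p ∣ * ∑[ x < n ] (g x * g x)                         ∎
  where
  open ≤-Reasoning
  𝟙g : Fin n → ℕ
  𝟙g x = 𝟙 (x ∈? p) * g x
  ∑g≡∑𝟙g : sum g ≡ sum 𝟙g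
  ∑g≡∑𝟙g = sum-cong-≗ pointwise
    where
    pointwise : ∀ x → g x ≡ 𝟙 (x ∈? p) * g x
    pointwise x with x ∈? p
    ... | yes _   = sym (+-identityʳ (g x))
    ... | no  x∉p = g≡0 x x∉p
  ∑𝟙𝟙≡∣p∣ : ∑[ x < n ] (𝟙 (x ∈? p) * 𝟙 (x ∈? p)) ≡ ∣ p ∣
  ∑𝟙𝟙≡∣p∣ = trans (sum-cong-≗ (λ x → 𝟙*𝟙≡𝟙 (x ∈? p))) (sym (∣p∣≡∑𝟙∈ p))

∃-below-average : ∀ {n} (p : Subset n) → Nonempty p → (e : Fin n → ℕ) {M : ℕ} →
  ∑[ x < n ] (𝟙 (x ∈? p) * e x) ≤ M → ∃[ x ] (x ∈ p × ∣ p ∣ * e x ≤ M)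
∃-below-average {n} p (x₀ , x₀∈p) e {M} ∑≤M
  with any? (λ x → (x ∈? p) ×-dec (∣ p ∣ * e x ≤? M))
... | yes below = below
... | no  ¬below = contradiction (*-cancelˡ-≤ ∣ p ∣ {{>-nonZero ∣p∣>0}} ∣p∣*[1+M]≤∣p∣*M) 1+n≰n
  where
  open ≤-Reasoning
  ∣p∣>0 : ∣ p ∣ > 0
  ∣p∣>0 = begin-strict
    0                       <⟨ z<s ⟩
    1                       ≡⟨ 𝟙-yes (x₀ ∈? p) x₀∈p ⟨
    𝟙 (x₀ ∈? p)             ≤⟨ f≤∑f (λ x → 𝟙 (x ∈? p)) x₀ ⟩
    ∑[ x < n ] 𝟙 (x ∈? p)   ≡⟨ ∣p∣≡∑𝟙∈ p ⟨
    ∣ p ∣                   ∎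
  above : ∀ x → 𝟙 (x ∈? p) * ℕ.suc M ≤ ∣ p ∣ * (𝟙 (x ∈? p) * e x)
  above x with x ∈? p
  ... | no  _   = z≤n
  ... | yes x∈p = begin
    ℕ.suc M + 0             ≡⟨ +-identityʳ _ ⟩
    ℕ.suc M                 ≤⟨ ≰⇒> (λ ∣p∣*eₓ≤M → ¬below (x , x∈p , ∣p∣*eₓ≤M)) ⟩
    ∣ p ∣ * e x             ≡⟨ cong (∣ p ∣ *_) (+-identityʳ (e x)) ⟨
    ∣ p ∣ * (e x + 0)       ∎
  ∣p∣*[1+M]≤∣p∣*M : ∣ p ∣ * ℕ.suc M ≤ ∣ p ∣ * M
  ∣p∣*[1+M]≤∣p∣*M = begin
    ∣ p ∣ * ℕ.suc M                                 ≡⟨ cong (_* ℕ.suc M) (∣p∣≡∑𝟙∈ p) ⟩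
    ∑[ x < n ] 𝟙 (x ∈? p) * ℕ.suc M                 ≡⟨ *-distribʳ-sum (ℕ.suc M) (λ x → 𝟙 (x ∈? p)) ⟩
    ∑[ x < n ] (𝟙 (x ∈? p) * ℕ.suc M)               ≤⟨ ∑-mono-≤ above ⟩
    ∑[ x < n ] (∣ p ∣ * (𝟙 (x ∈? p) * e x))         ≡⟨ *-distribˡ-sum ∣ p ∣ (λ x → 𝟙 (x ∈? p) * e x) ⟨
    ∣ p ∣ * ∑[ x < n ] (𝟙 (x ∈? p) * e x)           ≤⟨ *-monoʳ-≤ ∣ p ∣ ∑≤M ⟩
    ∣ p ∣ * M                                       ∎

-- Representation counts and energy

module _ {q : ℕ} .{{_ : NonZero q}} (A : Subset q) where

  χ : Fin q → ℕ
  χ a = 𝟙 (a ∈? A)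

  -- The decision procedure inside the definition of S, so that S ξ A can be read off from it.
  represents? : ∀ ξ a b x → Dec (a ∈ A × b ∈ A × line a b ξ ≡ x)
  represents? ξ a b x = (a ∈? A) ×-dec ((b ∈? A) ×-dec (line a b ξ ≟ x))

  representations : Fin q → Fin q → ℕ
  representations ξ x = ∑[ a < q ] ∑[ b < q ] 𝟙 (represents? ξ a b x)

  energy : Fin q → ℕ
  energy ξ = ∑[ x < q ] (representations ξ x * representations ξ x)

  represents⇒∈S : ∀ {ξ a b x} → a ∈ A × b ∈ A × line a b ξ ≡ x → x ∈ S ξ A
  represents⇒∈S {ξ} {a} {b} {x} h = lookup⇒[]= x (S ξ A) (begin
    lookup (S ξ A) x ≡⟨ lookup∘tabulate (λ y → isYes (representable? y)) x ⟩
    isYes (representable? x) ≡⟨ isYes≗does (representable? x) ⟩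
    does (representable? x) ≡⟨ dec-true (representable? x) (a , b , h) ⟩
    true                       ∎)
    where
    open ≡-Reasoning
    representable? : ∀ y → Dec (∃[ a ] ∃[ b ] (a ∈ A × b ∈ A × line a b ξ ≡ y))
    representable? y = any? λ a → any? λ b → represents? ξ a b y

  ∉S⇒representations≡0 : ∀ ξ x → x ∉ S ξ A → representations ξ x ≡ 0
  ∉S⇒representations≡0 ξ x x∉S =
    ∑-≡0 λ a → ∑-≡0 λ b → 𝟙-no (represents? ξ a b x) (x∉S ∘ represents⇒∈S)

  𝟙-represents : ∀ ξ a b x → 𝟙 (represents? ξ a b x) ≡ χ a * χ b * 𝟙 (line a b ξ ≟ x)
  𝟙-represents ξ a b x = begin
    𝟙 (represents? ξ a b x)                        ≡⟨ 𝟙-×-dec (a ∈? A) ((b ∈? A) ×-dec (line a b ξ ≟ x)) ⟩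
    χ a * 𝟙 ((b ∈? A) ×-dec (line a b ξ ≟ x))      ≡⟨ cong (χ a *_) (𝟙-×-dec (b ∈? A) (line a b ξ ≟ x)) ⟩
    χ a * (χ b * 𝟙 (line a b ξ ≟ x))               ≡⟨ *-assoc (χ a) (χ b) _ ⟨
    χ a * χ b * 𝟙 (line a b ξ ≟ x)                 ∎
    where open ≡-Reasoning

  ∑-*-representations : ∀ ξ (h : Fin q → ℕ) →
    ∑[ x < q ] (h x * representations ξ x) ≡ ∑[ a < q ] ∑[ b < q ] (χ a * χ b * h (line a b ξ))
  ∑-*-representations ξ h = trans (∑*∑∑≡∑∑∑* h (λ x a b → 𝟙 (represents? ξ a b x)))
                     (sum-cong-≗ λ a → sum-cong-≗ λ b → ∑-over-line a b)
    where
    open ≡-Reasoning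
    reorder : ∀ h i c → h * (c * i) ≡ c * (i * h)
    reorder = solve-∀
    ∑-over-line : ∀ a b → ∑[ x < q ] (h x * 𝟙 (represents? ξ a b x)) ≡ χ a * χ b * h (line a b ξ)
    ∑-over-line a b = begin
      ∑[ x < q ] (h x * 𝟙 (represents? ξ a b x))
        ≡⟨ sum-cong-≗ (λ x → trans (cong (h x *_) (𝟙-represents ξ a b x)) (reorder (h x) _ (χ a * χ b))) ⟩
      ∑[ x < q ] (χ a * χ b * (𝟙 (line a b ξ ≟ x) * h x))
        ≡⟨ *-distribˡ-sum (χ a * χ b) (λ x → 𝟙 (line a b ξ ≟ x) * h x) ⟨
      χ a * χ b * ∑[ x < q ] (𝟙 (line a b ξ ≟ x) * h x)
        ≡⟨ cong (χ a * χ b *_) (∑-δ (line a b ξ) h) ⟩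
      χ a * χ b * h (line a b ξ) ∎

  ∑∑χ*χ≡∣A∣² : ∑[ a < q ] ∑[ b < q ] (χ a * χ b) ≡ ∣ A ∣ * ∣ A ∣
  ∑∑χ*χ≡∣A∣² = trans (sym (∑*∑≡∑∑ χ χ)) (cong₂ _*_ (sym (∣p∣≡∑𝟙∈ A)) (sym (∣p∣≡∑𝟙∈ A)))

  ∑-representations≡∣A∣² : ∀ ξ → sum (representations ξ) ≡ ∣ A ∣ * ∣ A ∣
  ∑-representations≡∣A∣² ξ = begin
    sum (representations ξ)               ≡⟨ sum-cong-≗ (λ x → *-identityˡ (representations ξ x)) ⟨
    ∑[ x < q ] (1 * representations ξ x)  ≡⟨ ∑-*-representations ξ (λ _ → 1) ⟩
    ∑[ a < q ] ∑[ b < q ] (χ a * χ b * 1) ≡⟨ sum-cong-≗ (λ a → sum-cong-≗ λ b → *-identityʳ (χ a * χ b)) ⟩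
    ∑[ a < q ] ∑[ b < q ] (χ a * χ b)     ≡⟨ ∑∑χ*χ≡∣A∣² ⟩
    ∣ A ∣ * ∣ A ∣                         ∎
    where open ≡-Reasoning

  ∣A∣⁴≤∣S∣*energy : ∀ ξ → ∣ A ∣ * ∣ A ∣ * (∣ A ∣ * ∣ A ∣) ≤ ∣ S ξ A ∣ * energy ξ
  ∣A∣⁴≤∣S∣*energy ξ =
    subst (_≤ ∣ S ξ A ∣ * energy ξ) (cong₂ _*_ (∑-representations≡∣A∣² ξ) (∑-representations≡∣A∣² ξ))
      (∑-cauchy-schwarz-support (S ξ A) (representations ξ) (∉S⇒representations≡0 ξ))

  module _ (q-prime : Prime q) (G : Subset q) where

    χG : Fin q → ℕ
    χG ξ = 𝟙 (ξ ∈? G)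

    coincidences : Fin q → Fin q → Fin q → Fin q → ℕ
    coincidences a b a′ b′ = ∑[ ξ < q ] (χG ξ * 𝟙 (line a′ b′ ξ ≟ line a b ξ))

    coincidences-≤1 : ∀ a b a′ b′ → ¬ (a′ ≡ a × b′ ≡ b) → coincidences a b a′ b′ ≤ 1
    coincidences-≤1 a b a′ b′ distinct = begin
      coincidences a b a′ b′                          ≤⟨ ∑-mono-≤ (λ ξ → *-monoˡ-≤ _ (𝟙≤1 (ξ ∈? G))) ⟩
      ∑[ ξ < q ] (1 * 𝟙 (line a′ b′ ξ ≟ line a b ξ))  ≡⟨ sum-cong-≗ (λ ξ → *-identityˡ (𝟙 (line a′ b′ ξ ≟ line a b ξ))) ⟩
      ∑[ ξ < q ] 𝟙 (line a′ b′ ξ ≟ line a b ξ)        ≤⟨ ∑-𝟙-≤1 (λ ξ → line a′ b′ ξ ≟ line a b ξ) meet-once ⟩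
      1                                               ∎
      where
      open ≤-Reasoning
      meet-once : ∀ {ξ η} → line a′ b′ ξ ≡ line a b ξ → line a′ b′ η ≡ line a b η → ξ ≡ η
      meet-once {ξ} {η} atξ atη with lines-meet-once q-prime {a′} {a} {b′} {b} {ξ} {η} atξ atη
      ... | inj₁ same = contradiction same distinct
      ... | inj₂ ξ≡η  = ξ≡η

    coincidences-same-line : ∀ a b → coincidences a b a b ≡ ∣ G ∣
    coincidences-same-line a b = begin
      coincidences a b a b ≡⟨ sum-cong-≗ (λ ξ → cong (χG ξ *_) (𝟙-yes (line a b ξ ≟ line a b ξ) refl)) ⟩
      ∑[ ξ < q ] (χG ξ * 1) ≡⟨ sum-cong-≗ (λ ξ → *-identityʳ (χG ξ)) ⟩
      sum χG ≡⟨ ∣p∣≡∑𝟙∈ G ⟨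
      ∣ G ∣ ∎
      where open ≡-Reasoning

    coincidences-≤ : ∀ a b a′ b′ → coincidences a b a′ b′ ≤ 1 + 𝟙 (a ≟ a′) * (𝟙 (b ≟ b′) * ∣ G ∣)
    coincidences-≤ a b a′ b′ with a ≟ a′ | b ≟ b′
    ... | yes refl | yes refl = begin
      coincidences a b a b       ≡⟨ coincidences-same-line a b ⟩
      ∣ G ∣                      ≡⟨ *-identityˡ ∣ G ∣ ⟨
      1 * ∣ G ∣                  ≡⟨ *-identityˡ (1 * ∣ G ∣) ⟨
      1 * (1 * ∣ G ∣)            ≤⟨ m≤n+m _ 1 ⟩
      1 + 1 * (1 * ∣ G ∣)        ∎
      where open ≤-Reasoning
    ... | no a≢a′  | _        = ≤-trans (coincidences-≤1 a b a′ b′ (a≢a′ ∘ sym ∘ proj₁)) (m≤m+n 1 _)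
    ... | yes _    | no b≢b′  = ≤-trans (coincidences-≤1 a b a′ b′ (b≢b′ ∘ sym ∘ proj₂)) (m≤m+n 1 _)

    ∑G-representations∘line≤ : ∀ a b →
      ∑[ ξ < q ] (χG ξ * representations ξ (line a b ξ)) ≤ ∣ A ∣ * ∣ A ∣ + ∣ G ∣
    ∑G-representations∘line≤ a b = begin
      ∑[ ξ < q ] (χG ξ * representations ξ (line a b ξ))
        ≡⟨ ∑*∑∑≡∑∑∑* χG (λ ξ a′ b′ → 𝟙 (represents? ξ a′ b′ (line a b ξ))) ⟩
      ∑[ a′ < q ] ∑[ b′ < q ] ∑[ ξ < q ] (χG ξ * 𝟙 (represents? ξ a′ b′ (line a b ξ)))
        ≡⟨ sum-cong-≗ (λ a′ → sum-cong-≗ λ b′ → factor a′ b′) ⟩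
      ∑[ a′ < q ] ∑[ b′ < q ] (χ a′ * χ b′ * coincidences a b a′ b′)
        ≤⟨ ∑-mono-≤ (λ a′ → ∑-mono-≤ λ b′ →
             m≤1⇒n≤1+o⇒m*n≤m+o (*-mono-≤ (𝟙≤1 (a′ ∈? A)) (𝟙≤1 (b′ ∈? A))) (coincidences-≤ a b a′ b′)) ⟩
      ∑[ a′ < q ] ∑[ b′ < q ] (χ a′ * χ b′ + 𝟙 (a ≟ a′) * (𝟙 (b ≟ b′) * ∣ G ∣))
        ≡⟨ sum-cong-≗ (λ a′ → ∑-distrib-+ (λ b′ → χ a′ * χ b′) (λ b′ → 𝟙 (a ≟ a′) * (𝟙 (b ≟ b′) * ∣ G ∣))) ⟩
      ∑[ a′ < q ] (∑[ b′ < q ] (χ a′ * χ b′) + ∑[ b′ < q ] (𝟙 (a ≟ a′) * (𝟙 (b ≟ b′) * ∣ G ∣)))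
        ≡⟨ ∑-distrib-+ (λ a′ → ∑[ b′ < q ] (χ a′ * χ b′)) (λ a′ → ∑[ b′ < q ] (𝟙 (a ≟ a′) * (𝟙 (b ≟ b′) * ∣ G ∣))) ⟩
      ∑[ a′ < q ] ∑[ b′ < q ] (χ a′ * χ b′) + ∑[ a′ < q ] ∑[ b′ < q ] (𝟙 (a ≟ a′) * (𝟙 (b ≟ b′) * ∣ G ∣))
        ≡⟨ cong₂ _+_ ∑∑χ*χ≡∣A∣² ∑∑δ*δ*∣G∣≡∣G∣ ⟩
      ∣ A ∣ * ∣ A ∣ + ∣ G ∣ ∎
      where
      open ≤-Reasoning
      factor : ∀ a′ b′ → ∑[ ξ < q ] (χG ξ * 𝟙 (represents? ξ a′ b′ (line a b ξ)))
                       ≡ χ a′ * χ b′ * coincidences a b a′ b′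
      factor a′ b′ = trans (sum-cong-≗ λ ξ → cong (χG ξ *_) (𝟙-represents ξ a′ b′ (line a b ξ)))
                           (∑[c*[k*f]]≡k*∑[c*f] χG (λ ξ → 𝟙 (line a′ b′ ξ ≟ line a b ξ)) (χ a′ * χ b′))
      ∑∑δ*δ*∣G∣≡∣G∣ : ∑[ a′ < q ] ∑[ b′ < q ] (𝟙 (a ≟ a′) * (𝟙 (b ≟ b′) * ∣ G ∣)) ≡ ∣ G ∣
      ∑∑δ*δ*∣G∣≡∣G∣ = trans (sum-cong-≗ λ a′ → trans (sym (*-distribˡ-sum (𝟙 (a ≟ a′)) (λ b′ → 𝟙 (b ≟ b′) * ∣ G ∣)))
                                                     (cong (𝟙 (a ≟ a′) *_) (∑-δ b (λ _ → ∣ G ∣))))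
                            (∑-δ a (λ _ → ∣ G ∣))

    ∑G-energy≤ : ∑[ ξ < q ] (χG ξ * energy ξ) ≤ ∣ A ∣ * ∣ A ∣ * (∣ A ∣ * ∣ A ∣ + ∣ G ∣)
    ∑G-energy≤ = begin
      ∑[ ξ < q ] (χG ξ * energy ξ)
        ≡⟨ sum-cong-≗ (λ ξ → cong (χG ξ *_) (∑-*-representations ξ (representations ξ))) ⟩
      ∑[ ξ < q ] (χG ξ * ∑[ a < q ] ∑[ b < q ] (χ a * χ b * representations ξ (line a b ξ)))
        ≡⟨ ∑*∑∑≡∑∑∑* χG (λ ξ a b → χ a * χ b * representations ξ (line a b ξ)) ⟩
      ∑[ a < q ] ∑[ b < q ] ∑[ ξ < q ] (χG ξ * (χ a * χ b * representations ξ (line a b ξ)))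
        ≡⟨ sum-cong-≗ (λ a → sum-cong-≗ λ b → ∑[c*[k*f]]≡k*∑[c*f] χG (λ ξ → representations ξ (line a b ξ)) (χ a * χ b)) ⟩
      ∑[ a < q ] ∑[ b < q ] (χ a * χ b * ∑[ ξ < q ] (χG ξ * representations ξ (line a b ξ)))
        ≤⟨ ∑-mono-≤ (λ a → ∑-mono-≤ λ b → *-monoʳ-≤ (χ a * χ b) (∑G-representations∘line≤ a b)) ⟩
      ∑[ a < q ] ∑[ b < q ] (χ a * χ b * M)
        ≡⟨ sum-cong-≗ (λ a → *-distribʳ-sum M (λ b → χ a * χ b)) ⟨
      ∑[ a < q ] (∑[ b < q ] (χ a * χ b) * M)
        ≡⟨ *-distribʳ-sum M (λ a → ∑[ b < q ] (χ a * χ b)) ⟨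
      ∑[ a < q ] ∑[ b < q ] (χ a * χ b) * M
        ≡⟨ cong (_* M) ∑∑χ*χ≡∣A∣² ⟩
      ∣ A ∣ * ∣ A ∣ * M ∎
      where
      open ≤-Reasoning
      M = ∣ A ∣ * ∣ A ∣ + ∣ G ∣

lemma2 : (q : ℕ) .{{_ : NonZero q}} → Prime q → (A G : Subset q) →
         (∀ g → g ∈ G → ¬ toℕ g ≡ 0) → Nonempty G →
         ∃[ ξ ] (ξ ∈ G ×
           ∣ A ∣ * ∣ A ∣ * ∣ G ∣ ≤ ∣ S ξ A ∣ * (∣ A ∣ * ∣ A ∣ + ∣ G ∣))
lemma2 q q-prime A G _ G≢∅ with ∃-below-average G G≢∅ (energy A) (∑G-energy≤ A q-prime G)
... | ξ , ξ∈G , ∣G∣*energy≤ =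
  ξ , ξ∈G , m*m≤n*o⇒p*o≤m*[m+p]⇒m*p≤n*[m+p] {∣ A ∣ * ∣ A ∣} {∣ S ξ A ∣} {energy A ξ}
              (∣A∣⁴≤∣S∣*energy A ξ) ∣G∣*energy≤
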